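{- Let $n \ge 5$ be a fixed integer with $n \equiv 1 \pmod 4$, and let $\Delta_n(u,v) = (n-1)^{n-1}u^n + n^n v^{n-1}$. For every odd prime $\ell$, $$ S_n(\ell) := \sum_{u,v=1}^{\ell} \left(\frac{\Delta_n(u,v)}{\ell}\right) \ll \ell . $$
   Context: $\left(\frac{w}{\ell}\right)$ denotes the Legendre symbol modulo $\ell$. The notation $U \ll V$ means $|U|\le cV$ with a constant $c>0$ depending only on $n$. -}

module Defs where

open import Data.Nat using (ℕ; zero; suc; _+_; _*_; _∸_; _^_; _%_)
open import Data.Nat.Properties using (_≟_)
open import Data.Integer using (ℤ; 0ℤ; 1ℤ; -1ℤ) renaming (_+_ to _+ℤ_)
open import Data.List using (List; upTo; map; foldr)
open import Data.Bool.ListAction using (any)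
open import Data.Bool using (if_then_else_)
open import Relation.Nullary.Decidable using (⌊_⌋; yes; no)

-- Legendre symbol (a / ℓ) for a prime ℓ, defined as in the paper:
-- 0 if ℓ ∣ a, 1 if a is a nonzero square mod ℓ, -1 otherwise.
-- (The value for ℓ = 0 is an irrelevant junk value.)
legendre : ℕ → ℕ → ℤ
legendre a zero = 0ℤ
legendre a (suc k) with a % suc k ≟ 0
... | yes _ = 0ℤ
... | no _ = if any (λ x → ⌊ (x * x) % suc k ≟ a % suc k ⌋) (upTo (suc k))
               then 1ℤ else -1ℤ

sumℤ : List ℤ → ℤ
sumℤ = foldr _+ℤ_ 0ℤ

oneTo : ℕ → List ℕ
oneTo m = map suc (upTo m)

Δ : ℕ → ℕ → ℕ → ℕ
Δ n u v = (n ∸ 1) ^ (n ∸ 1) * u ^ n + n ^ n * v ^ (n ∸ 1)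

S : ℕ → ℕ → ℤ
S n ℓ = sumℤ (map (λ u → sumℤ (map (λ v → legendre (Δ n u v) ℓ) (oneTo ℓ))) (oneTo ℓ))

module Submission where

-- For ℓ ≤ n it is the trivial bound |S n ℓ| ≤ ℓ² ≤ n ℓ.  For ℓ > n the sum vanishes
-- exactly: write e = n - 1 (even, e = 2h), A = e^e (a unit mod ℓ) and B = n^n, so that
-- S n ℓ = Σ_{u,v} (A u^(e+1) + B v^e / ℓ).  For a unit u, substituting v = u w and
-- removing the square factor u^e = (u^h)² turns the row u into Σ_w (A u + B w^e / ℓ);
-- summing over the units u and using Σ_u (A u + c / ℓ) = 0 (the character sum over all
-- residues vanishes, u ↦ A u + c being a permutation) gives minus the row u = 0.

open import Defs
open import Data.Nat as ℕ
  using (ℕ; zero; suc; _+_; _*_; _∸_; _^_; _%_; _/_; _≤_; _<_; z≤n; s≤s; _≡ᵇ_; NonZero)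
import Data.Nat.Properties as ℕP
open import Data.Nat.DivMod
open import Data.Nat.Divisibility using (_∣_; divides; n∣m*n; n∣m⇒m%n≡0; m%n≡0⇒n∣m)
open import Data.Nat.Primality using (Prime; euclidsLemma; prime⇒nonTrivial; prime⇒irreducible)
open import Data.Nat.Coprimality using (Coprime; coprime-Bézout)
open import Data.Nat.GCD using (module Bézout)
open import Data.Nat.Tactic.RingSolver using (solve-∀)
open import Data.Product using (∃; ∃-syntax; _,_; proj₁; proj₂)
open import Relation.Binary.Bundles using (Setoid)
open import Relation.Binary.Structures using (IsEquivalence)
import Relation.Binary.Reasoning.Setoid as SetoidReasoning
open import Data.Integer as ℤ using (ℤ; 0ℤ; 1ℤ; -1ℤ; +_; -_; ∣_∣) renaming (_+_ to _+ℤ_)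
import Data.Integer.Properties as ℤP
open import Algebra.Properties.CommutativeSemigroup ℤP.+-commutativeSemigroup using (interchange)
open import Algebra.Properties.AbelianGroup ℤP.+-0-abelianGroup using (inverseʳ-unique)
open import Data.Bool using (Bool; true; false; if_then_else_; T)
open import Data.Unit using (tt)
open import Data.Empty using (⊥-elim)
open import Data.Sum using (_⊎_; inj₁; inj₂; [_,_]′) renaming (map to ⊎-map)
open import Data.List using (map; applyUpTo; upTo)
open import Data.Bool.ListAction using (any)
open import Data.List.Relation.Unary.Any using (satisfied)
open import Data.List.Relation.Unary.Any.Properties using (any⁺; any⁻)
open import Data.List.Membership.Propositional using (_∈_; lose)
open import Data.List.Membership.Propositional.Properties using (∈-upTo⁺)
open import Relation.Nullary.Decidable using (⌊_⌋; toWitness; fromWitness)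
open import Function using (id; _∘_; _⇔_; mk⇔; Equivalence)
open import Relation.Nullary using (¬_; yes; no)
open import Relation.Binary.PropositionalEquality

Σ : ℕ → (ℕ → ℤ) → ℤ
Σ zero    f = 0ℤ
Σ (suc m) f = f 0 +ℤ Σ m (f ∘ suc)

Σ-cong : ∀ m {f g : ℕ → ℤ} → (∀ x → x < m → f x ≡ g x) → Σ m f ≡ Σ m g
Σ-cong zero    f≗g = refl
Σ-cong (suc m) f≗g =
  cong₂ _+ℤ_ (f≗g 0 (s≤s z≤n)) (Σ-cong m (λ x x<m → f≗g (suc x) (s≤s x<m)))

Σ-+ : ∀ m (f g : ℕ → ℤ) → Σ m (λ x → f x +ℤ g x) ≡ Σ m f +ℤ Σ m g
Σ-+ zero    f g = refl
Σ-+ (suc m) f g = trans (cong ((f 0 +ℤ g 0) +ℤ_) (Σ-+ m (f ∘ suc) (g ∘ suc)))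
                        (interchange (f 0) (g 0) (Σ m (f ∘ suc)) (Σ m (g ∘ suc)))

Σ-neg : ∀ m (f : ℕ → ℤ) → Σ m (λ x → - f x) ≡ - Σ m f
Σ-neg zero    f = refl
Σ-neg (suc m) f = trans (cong (- f 0 +ℤ_) (Σ-neg m (f ∘ suc))) (sym (ℤP.neg-distrib-+ (f 0) _))

Σ-zero : ∀ m {f : ℕ → ℤ} → (∀ x → x < m → f x ≡ 0ℤ) → Σ m f ≡ 0ℤ
Σ-zero zero    f≗0 = refl
Σ-zero (suc m) f≗0 =
  cong₂ _+ℤ_ (f≗0 0 (s≤s z≤n)) (Σ-zero m (λ x x<m → f≗0 (suc x) (s≤s x<m)))

Σ-one : ∀ m → Σ m (λ _ → 1ℤ) ≡ + m
Σ-one zero    = refl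
Σ-one (suc m) = cong (1ℤ +ℤ_) (Σ-one m)

Σ-swap : ∀ m n (h : ℕ → ℕ → ℤ) → Σ m (λ x → Σ n (h x)) ≡ Σ n (λ y → Σ m (λ x → h x y))
Σ-swap zero    n h = sym (Σ-zero n (λ _ _ → refl))
Σ-swap (suc m) n h = trans (cong (Σ n (h 0) +ℤ_) (Σ-swap m n (h ∘ suc)))
                           (sym (Σ-+ n (h 0) (λ y → Σ m (λ x → h (suc x) y))))

Σ-snoc : ∀ m (f : ℕ → ℤ) → Σ (suc m) f ≡ Σ m f +ℤ f m
Σ-snoc zero    f = ℤP.+-comm (f 0) 0ℤ
Σ-snoc (suc m) f = trans (cong (f 0 +ℤ_) (Σ-snoc m (f ∘ suc))) (sym (ℤP.+-assoc (f 0) _ _))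

Σ-shift : ∀ m (f : ℕ → ℤ) → f m ≡ f 0 → Σ m (f ∘ suc) ≡ Σ m f
Σ-shift zero    f _     = refl
Σ-shift (suc m) f fm≡f0 = begin
    Σ (suc m) (f ∘ suc)         ≡⟨ Σ-snoc m (f ∘ suc) ⟩
    Σ m (f ∘ suc) +ℤ f (suc m)  ≡⟨ cong (Σ m (f ∘ suc) +ℤ_) fm≡f0 ⟩
    Σ m (f ∘ suc) +ℤ f 0        ≡⟨ ℤP.+-comm _ (f 0) ⟩
    Σ (suc m) f                 ∎
  where open ≡-Reasoning

Σ-bound : ∀ m (b : ℕ) (f : ℕ → ℤ) → (∀ x → ∣ f x ∣ ≤ b) → ∣ Σ m f ∣ ≤ m * b
Σ-bound zero    b f _     = z≤n
Σ-bound (suc m) b f ∣f∣≤b = ℕP.≤-trans (ℤP.∣i+j∣≤∣i∣+∣j∣ (f 0) _)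
                                       (ℕP.+-mono-≤ (∣f∣≤b 0) (Σ-bound m b (f ∘ suc) (∣f∣≤b ∘ suc)))

δ : ℕ → ℕ → ℤ → ℤ
δ a b z = if a ≡ᵇ b then z else 0ℤ

δ-yes : ∀ {a b} z → a ≡ b → δ a b z ≡ z
δ-yes {a} {b} z a≡b with a ≡ᵇ b | ℕP.≡⇒≡ᵇ a b a≡b
... | true  | _  = refl
... | false | ()

δ-no : ∀ {a b} z → a ≢ b → δ a b z ≡ 0ℤ
δ-no {a} {b} z a≢b with a ≡ᵇ b in a≡ᵇb
... | true  = ⊥-elim (a≢b (ℕP.≡ᵇ⇒≡ a b (subst T (sym a≡ᵇb) tt)))
... | false = refl

δ-cong : ∀ {a b c d} z → (a ≡ b ⇔ c ≡ d) → δ a b z ≡ δ c d z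
δ-cong {a} {b} z a≡b⇔c≡d with a ℕ.≟ b
... | yes a≡b = trans (δ-yes z a≡b) (sym (δ-yes z (Equivalence.to a≡b⇔c≡d a≡b)))
... | no  a≢b = trans (δ-no z a≢b) (sym (δ-no z (a≢b ∘ Equivalence.from a≡b⇔c≡d)))

δ-sym : ∀ a b z → δ a b z ≡ δ b a z
δ-sym a b z = δ-cong {a} {b} {b} {a} z (mk⇔ sym sym)

δ-split : ∀ {a b c d e} z → d ≢ e → (a ≡ b ⇔ (c ≡ d ⊎ c ≡ e)) → δ a b z ≡ δ c d z +ℤ δ c e z
δ-split {a} {b} {c} {d} {e} z d≢e a≡b⇔ with c ℕ.≟ d | c ℕ.≟ e
... | yes c≡d | yes c≡e = ⊥-elim (d≢e (trans (sym c≡d) c≡e))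
... | yes c≡d | no  c≢e = trans (δ-yes z (Equivalence.from a≡b⇔ (inj₁ c≡d)))
  (sym (trans (cong₂ _+ℤ_ (δ-yes z c≡d) (δ-no z c≢e)) (ℤP.+-identityʳ z)))
... | no  c≢d | yes c≡e = trans (δ-yes z (Equivalence.from a≡b⇔ (inj₂ c≡e)))
  (sym (trans (cong₂ _+ℤ_ (δ-no z c≢d) (δ-yes z c≡e)) (ℤP.+-identityˡ z)))
... | no  c≢d | no  c≢e = trans (δ-no z ([ c≢d , c≢e ]′ ∘ Equivalence.to a≡b⇔))
  (sym (cong₂ _+ℤ_ (δ-no z c≢d) (δ-no z c≢e)))

Σ-δ : ∀ m k (g : ℕ → ℤ) → k < m → Σ m (λ x → δ x k (g x)) ≡ g k
Σ-δ (suc m) zero    g _         =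
  trans (cong (g 0 +ℤ_) (Σ-zero m (λ _ _ → refl))) (ℤP.+-identityʳ (g 0))
Σ-δ (suc m) (suc k) g (s≤s k<m) = trans (ℤP.+-identityˡ _) (Σ-δ m k (g ∘ suc) k<m)

Σ-δ′ : ∀ m k (g : ℕ → ℤ) → k < m → Σ m (λ x → δ k x (g x)) ≡ g k
Σ-δ′ m k g k<m = trans (Σ-cong m (λ x _ → δ-sym k x (g x))) (Σ-δ m k g k<m)

Σ-reindex : ∀ m (σ τ : ℕ → ℕ) (f : ℕ → ℤ) →
            (∀ x → x < m → σ x < m) → (∀ y → y < m → τ y < m) →
            (∀ x → x < m → τ (σ x) ≡ x) → (∀ y → y < m → σ (τ y) ≡ y) →
            Σ m (f ∘ σ) ≡ Σ m f
Σ-reindex m σ τ f σ<m τ<m τσ≗id στ≗id = begin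
    Σ m (f ∘ σ)
  ≡⟨ Σ-cong m (λ x x<m → Σ-δ′ m (σ x) f (σ<m x x<m)) ⟨
    Σ m (λ x → Σ m (λ y → δ (σ x) y (f y)))
  ≡⟨ Σ-swap m m (λ x y → δ (σ x) y (f y)) ⟩
    Σ m (λ y → Σ m (λ x → δ (σ x) y (f y)))
  ≡⟨ Σ-cong m (λ y y<m → Σ-cong m (λ x x<m → δ-cong (f y) (inverse x x<m y y<m))) ⟩
    Σ m (λ y → Σ m (λ x → δ x (τ y) (f y)))
  ≡⟨ Σ-cong m (λ y y<m → Σ-δ m (τ y) (λ _ → f y) (τ<m y y<m)) ⟩
    Σ m f
  ∎
  where
  open ≡-Reasoning
  inverse : ∀ x → x < m → ∀ y → y < m → σ x ≡ y ⇔ x ≡ τ y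
  inverse x x<m y y<m = mk⇔ (λ σx≡y → trans (sym (τσ≗id x x<m)) (cong τ σx≡y))
                            (λ x≡τy → trans (cong σ x≡τy) (στ≗id y y<m))

^-distribʳ-* : ∀ a b e → (a * b) ^ e ≡ a ^ e * b ^ e
^-distribʳ-* a b zero    = refl
^-distribʳ-* a b (suc e) =
  trans (cong ((a * b) *_) (^-distribʳ-* a b e)) (regroup a b (a ^ e) (b ^ e))
  where
  regroup : ∀ a b x y → (a * b) * (x * y) ≡ (a * x) * (b * y)
  regroup = solve-∀

%≡⇒∣∣-∣ : ∀ a b n .{{_ : NonZero n}} → a % n ≡ b % n → n ∣ ℕ.∣ a - b ∣
%≡⇒∣∣-∣ a b n a≡b = divides ℕ.∣ a / n - b / n ∣ (begin
    ℕ.∣ a - b ∣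
  ≡⟨ cong₂ ℕ.∣_-_∣ (m≡m%n+[m/n]*n a n) (m≡m%n+[m/n]*n b n) ⟩
    ℕ.∣ a % n + (a / n) * n - b % n + (b / n) * n ∣
  ≡⟨ cong (λ r → ℕ.∣ a % n + (a / n) * n - r + (b / n) * n ∣) a≡b ⟨
    ℕ.∣ a % n + (a / n) * n - a % n + (b / n) * n ∣
  ≡⟨ ℕP.∣m+n-m+o∣≡∣n-o∣ (a % n) _ _ ⟩
    ℕ.∣ (a / n) * n - (b / n) * n ∣
  ≡⟨ ℕP.*-distribʳ-∣-∣ n (a / n) (b / n) ⟨
    ℕ.∣ a / n - b / n ∣ * n
  ∎)
  where open ≡-Reasoning

-- m is congruent to -1 modulo m + 1, so its square is congruent to 1.
square≡1-mod-suc : ∀ m → (m * m) % suc m ≡ 1 % suc m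
square≡1-mod-suc zero    = refl
square≡1-mod-suc (suc j) =
  trans (cong (_% suc (suc j)) (expand j)) (%-remove-+ʳ 1 (n∣m*n j {suc (suc j)}))
  where
  expand : ∀ j → suc j * suc j ≡ 1 + j * suc (suc j)
  expand = solve-∀

module OddPrime (k : ℕ) (p-prime : Prime (suc k)) (p≢2 : suc k ≢ 2) where

  p : ℕ
  p = suc k

  0<p : 0 < p
  0<p = s≤s z≤n

  1<p : 1 < p
  1<p = ℕ.nonTrivial⇒n>1 p {{prime⇒nonTrivial p-prime}}

  infix 4 _≈_

  record _≈_ (a b : ℕ) : Set where
    constructor ⟨_⟩
    field residue : a % p ≡ b % p
  open _≈_

  ≈-isEquivalence : IsEquivalence _≈_
  ≈-isEquivalence = record
    { refl  = ⟨ refl ⟩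
    ; sym   = λ a≈b → ⟨ sym (residue a≈b) ⟩
    ; trans = λ a≈b b≈c → ⟨ trans (residue a≈b) (residue b≈c) ⟩
    }

  ≈-setoid : Setoid _ _
  ≈-setoid = record { isEquivalence = ≈-isEquivalence }

  open IsEquivalence ≈-isEquivalence public
    using () renaming (refl to ≈-refl; sym to ≈-sym; trans to ≈-trans; reflexive to ≡⇒≈)
  module ≈-Reasoning = SetoidReasoning ≈-setoid

  ≈-+ : ∀ {a a′ b b′} → a ≈ a′ → b ≈ b′ → a + b ≈ a′ + b′
  ≈-+ {a} {a′} {b} {b′} ⟨ a≡a′ ⟩ ⟨ b≡b′ ⟩ = ⟨ trans (%-distribˡ-+ a b p)
    (trans (cong₂ (λ x y → (x + y) % p) a≡a′ b≡b′) (sym (%-distribˡ-+ a′ b′ p))) ⟩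

  ≈-* : ∀ {a a′ b b′} → a ≈ a′ → b ≈ b′ → a * b ≈ a′ * b′
  ≈-* {a} {a′} {b} {b′} ⟨ a≡a′ ⟩ ⟨ b≡b′ ⟩ = ⟨ trans (%-distribˡ-* a b p)
    (trans (cong₂ (λ x y → (x * y) % p) a≡a′ b≡b′) (sym (%-distribˡ-* a′ b′ p))) ⟩

  ≈-^ : ∀ {a a′} e → a ≈ a′ → a ^ e ≈ a′ ^ e
  ≈-^ zero    _    = ≈-refl
  ≈-^ (suc e) a≈a′ = ≈-* a≈a′ (≈-^ e a≈a′)

  %≈ : ∀ a → a % p ≈ a
  %≈ a = ⟨ m%n%n≡m%n a p ⟩

  multiple≈0 : ∀ m → m * p ≈ 0
  multiple≈0 m = ⟨ m*n%n≡0 m p ⟩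

  p≈0 : p ≈ 0
  p≈0 = ⟨ n%n≡0 p ⟩

  ≈⇒≡ : ∀ {a b} → a < p → b < p → a ≈ b → a ≡ b
  ≈⇒≡ {a} {b} a<p b<p ⟨ a≡b ⟩ = trans (sym (m<n⇒m%n≡m a<p)) (trans a≡b (m<n⇒m%n≡m b<p))

  ∣⇒≈0 : ∀ {a} → p ∣ a → a ≈ 0
  ∣⇒≈0 {a} p∣a = ⟨ n∣m⇒m%n≡0 a p p∣a ⟩

  ≈0⇒∣ : ∀ {a} → a ≈ 0 → p ∣ a
  ≈0⇒∣ {a} ⟨ a≈0 ⟩ = m%n≡0⇒n∣m a p a≈0

  ≈0-* : ∀ {a b} → a * b ≈ 0 → a ≈ 0 ⊎ b ≈ 0
  ≈0-* {a} {b} ab≈0 with euclidsLemma a b p-prime (≈0⇒∣ ab≈0)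
  ... | inj₁ p∣a = inj₁ (∣⇒≈0 p∣a)
  ... | inj₂ p∣b = inj₂ (∣⇒≈0 p∣b)

  ≉0-^ : ∀ {a} e → ¬ a ≈ 0 → ¬ a ^ e ≈ 0
  ≉0-^ zero    _   1≈0  with ≈⇒≡ 1<p 0<p 1≈0
  ... | ()
  ≉0-^ (suc e) a≉0 aᵉ⁺¹≈0 with ≈0-* aᵉ⁺¹≈0
  ... | inj₁ a≈0  = a≉0 a≈0
  ... | inj₂ aᵉ≈0 = ≉0-^ e a≉0 aᵉ≈0

  inverse : ∀ {a} → ¬ a ≈ 0 → ∃ λ a′ → a * a′ ≈ 1
  inverse {a} a≉0 with coprime-Bézout coprime
    where
    coprime : Coprime a p
    coprime (d∣a , d∣p) with prime⇒irreducible p-prime d∣p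
    ... | inj₁ d≡1 = d≡1
    ... | inj₂ refl = ⊥-elim (a≉0 (∣⇒≈0 d∣a))
  ... | Bézout.+- x y 1+yp≡xa = x , ⟨ trans (cong (_% p) (ℕP.*-comm a x))
      (trans (cong (_% p) (sym 1+yp≡xa)) (%-remove-+ʳ 1 (n∣m*n y {p}))) ⟩
  ... | Bézout.-+ x y 1+xa≡yp = x * k , (begin
      a * (x * k)  ≡⟨ rearrange a x k ⟩
      (x * a) * k  ≈⟨ ≈-* xa≈k ≈-refl ⟩
      k * k        ≈⟨ ⟨ square≡1-mod-suc k ⟩ ⟩
      1            ∎)
    where
    open ≈-Reasoning
    rearrange : ∀ a x k → a * (x * k) ≡ (x * a) * k
    rearrange = solve-∀
    -- x * a ≡ -1 ≡ k modulo p
    xa≈k : x * a ≈ k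
    xa≈k = ⟨ trans (%-pred-≡0 (trans (cong (_% p) 1+xa≡yp) (n∣m⇒m%n≡0 _ p (n∣m*n y))))
                   (sym (m<n⇒m%n≡m (ℕP.n<1+n k))) ⟩

  multiple-below-2p : ∀ {m} → p ∣ m → m < p + p → m ≡ 0 ⊎ m ≡ p
  multiple-below-2p (divides zero          m≡0)  _    = inj₁ m≡0
  multiple-below-2p (divides (suc zero)    m≡1p) _    = inj₂ (trans m≡1p (ℕP.*-identityˡ p))
  multiple-below-2p (divides (suc (suc q)) m≡)   m<2p =
    ⊥-elim (ℕP.<⇒≱ m<2p (subst (p + p ≤_) (sym m≡) (ℕP.+-monoʳ-≤ p (ℕP.m≤m+n p (q * p)))))

  absorb : ∀ a b → a + b ≈ a → p ∣ b
  absorb a b a+b≈a = subst (p ∣_) (ℕP.∣m-m+n∣≡n a b) (%≡⇒∣∣-∣ a (a + b) p (sym (residue a+b≈a)))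

  -- For s ≤ x < p, x² ≡ s² forces p ∣ (x - s)(x + s), hence x = s or x + s = p.
  roots-of-square-ordered : ∀ {x s} → s ≤ x → x < p → x * x ≈ s * s → x ≡ s ⊎ x + s ≡ p
  roots-of-square-ordered {x} {s} s≤x x<p x²≈s² with euclidsLemma (x ∸ s) (x + s) p-prime p∣x²-s²
    where
    expand : ∀ s d → (s + d) * (s + d) ≡ s * s + d * ((s + d) + s)
    expand = solve-∀
    s+[x∸s]≡x : s + (x ∸ s) ≡ x
    s+[x∸s]≡x = ℕP.m+[n∸m]≡n s≤x
    difference-of-squares : x * x ≡ s * s + (x ∸ s) * (x + s)
    difference-of-squares = begin
        x * x                                  ≡⟨ cong (λ y → y * y) s+[x∸s]≡x ⟨
        (s + (x ∸ s)) * (s + (x ∸ s))          ≡⟨ expand s (x ∸ s) ⟩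
        s * s + (x ∸ s) * ((s + (x ∸ s)) + s)  ≡⟨ cong (λ y → s * s + (x ∸ s) * (y + s)) s+[x∸s]≡x ⟩
        s * s + (x ∸ s) * (x + s)              ∎
      where open ≡-Reasoning
    p∣x²-s² : p ∣ (x ∸ s) * (x + s)
    p∣x²-s² = absorb (s * s) _ (subst (_≈ s * s) difference-of-squares x²≈s²)
  ... | inj₁ p∣x∸s = inj₁ (ℕP.≤-antisym (ℕP.m∸n≡0⇒m≤n x∸s≡0) s≤x)
    where
    x∸s≡0 : x ∸ s ≡ 0
    x∸s≡0 = ≈⇒≡ (ℕP.≤-<-trans (ℕP.m∸n≤m x s) x<p) 0<p (∣⇒≈0 p∣x∸s)
  ... | inj₂ p∣x+s with multiple-below-2p p∣x+s (ℕP.+-mono-< x<p (ℕP.≤-<-trans s≤x x<p))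
  ...   | inj₁ x+s≡0 = inj₁ (trans (ℕP.m+n≡0⇒m≡0 x x+s≡0) (sym (ℕP.m+n≡0⇒n≡0 x x+s≡0)))
  ...   | inj₂ x+s≡p = inj₂ x+s≡p

  roots-of-square : ∀ {x s} → x < p → s < p → x * x ≈ s * s → x ≡ s ⊎ x + s ≡ p
  roots-of-square {x} {s} x<p s<p x²≈s² with ℕP.≤-total s x
  ... | inj₁ s≤x = roots-of-square-ordered s≤x x<p x²≈s²
  ... | inj₂ x≤s = ⊎-map sym (trans (ℕP.+-comm x s)) (roots-of-square-ordered x≤s s<p (≈-sym x²≈s²))

  opposite-squares : ∀ {x s} → x + s ≡ p → x * x ≈ s * s
  opposite-squares {x} {s} x+s≡p = begin
      x * x              ≡⟨ ℕP.+-identityʳ (x * x) ⟨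
      x * x + 0          ≈⟨ ≈-+ (≈-refl {x * x}) (≈-sym (multiple≈0 s)) ⟩
      x * x + s * p      ≡⟨ subst (λ q → x * x + s * q ≡ x * q + s * s) x+s≡p (swap x s) ⟩
      x * p + s * s      ≈⟨ ≈-+ (multiple≈0 x) (≈-refl {s * s}) ⟩
      s * s              ∎
    where
    open ≈-Reasoning
    swap : ∀ x s → x * x + s * (x + s) ≡ x * (x + s) + s * s
    swap = solve-∀

  square-roots : ∀ {x s} → x < p → s < p → (x * x ≈ s * s ⇔ (x ≡ s ⊎ x ≡ p ∸ s))
  square-roots {x} {s} x<p s<p = mk⇔
    (⊎-map id (λ x+s≡p → trans (sym (ℕP.m+n∸n≡m x s)) (cong (_∸ s) x+s≡p))
      ∘ roots-of-square x<p s<p)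
    [ (λ x≡s → ≡⇒≈ (cong (λ y → y * y) x≡s))
    , (λ x≡p∸s → opposite-squares {x} {s} (trans (cong (_+ s) x≡p∸s) (ℕP.m∸n+n≡m (ℕP.<⇒≤ s<p)))) ]′

  square≈0 : ∀ {x} → x < p → x * x ≈ 0 → x ≡ 0
  square≈0 x<p x²≈0 = [ ≈⇒≡ x<p 0<p , ≈⇒≡ x<p 0<p ]′ (≈0-* x²≈0)

  χ : ℕ → ℤ
  χ a = legendre a p

  IsSquare : ℕ → Set
  IsSquare a = ∃ λ s → s * s ≈ a

  data Character (a : ℕ) : ℤ → Set where
    divisible : a ≈ 0 → Character a 0ℤ
    square    : ¬ a ≈ 0 → IsSquare a → Character a 1ℤ
    nonsquare : ¬ a ≈ 0 → ¬ IsSquare a → Character a -1ℤ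

  is-root : ℕ → ℕ → Bool
  is-root a x = ⌊ (x * x) % p ℕ.≟ a % p ⌋

  root-found : ∀ a → any (is-root a) (upTo p) ≡ true → IsSquare a
  root-found a found with satisfied (any⁻ (is-root a) (upTo p) (subst T (sym found) tt))
  ... | s , s-is-root = s , ⟨ toWitness s-is-root ⟩

  root-not-found : ∀ a → any (is-root a) (upTo p) ≡ false → ¬ IsSquare a
  root-not-found a not-found (s , s²≈a) =
    subst T not-found (any⁺ (is-root a) (lose s%p∈range s%p-is-root))
    where
    s%p∈range : s % p ∈ upTo p
    s%p∈range = ∈-upTo⁺ (m%n<n s p)
    s%p-is-root : T (is-root a (s % p))
    s%p-is-root = fromWitness (residue (≈-trans (≈-* (%≈ s) (%≈ s)) s²≈a))

  character : ∀ a → Character a (χ a)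
  character a with a % p ℕ.≟ 0
  ... | yes a≡0 = divisible ⟨ a≡0 ⟩
  ... | no  a≢0 with any (is-root a) (upTo p) in found
  ...   | true  = square    (a≢0 ∘ residue) (root-found a found)
  ...   | false = nonsquare (a≢0 ∘ residue) (root-not-found a found)

  χ-ext : ∀ {a b} → (a ≈ 0 ⇔ b ≈ 0) → (IsSquare a ⇔ IsSquare b) → χ a ≡ χ b
  χ-ext {a} {b} zero⇔ square⇔ with χ a | character a | χ b | character b
  ... | _ | divisible _      | _ | divisible _      = refl
  ... | _ | divisible a≈0    | _ | square b≉0 _     = ⊥-elim (b≉0 (Equivalence.to zero⇔ a≈0))
  ... | _ | divisible a≈0    | _ | nonsquare b≉0 _  = ⊥-elim (b≉0 (Equivalence.to zero⇔ a≈0))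
  ... | _ | square a≉0 _     | _ | divisible b≈0    = ⊥-elim (a≉0 (Equivalence.from zero⇔ b≈0))
  ... | _ | square _ _       | _ | square _ _       = refl
  ... | _ | square _ a□      | _ | nonsquare _ b∉□  = ⊥-elim (b∉□ (Equivalence.to square⇔ a□))
  ... | _ | nonsquare a≉0 _  | _ | divisible b≈0    = ⊥-elim (a≉0 (Equivalence.from zero⇔ b≈0))
  ... | _ | nonsquare _ a∉□  | _ | square _ b□      = ⊥-elim (a∉□ (Equivalence.from square⇔ b□))
  ... | _ | nonsquare _ _    | _ | nonsquare _ _    = refl

  χ-cong : ∀ {a b} → a ≈ b → χ a ≡ χ b
  χ-cong a≈b = χ-ext (mk⇔ (≈-trans (≈-sym a≈b)) (≈-trans a≈b))
                     (mk⇔ (λ (s , s²≈a) → s , ≈-trans s²≈a a≈b)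
                          (λ (s , s²≈b) → s , ≈-trans s²≈b (≈-sym a≈b)))

  χ-square-factor : ∀ {t} z → ¬ t ≈ 0 → χ (t * t * z) ≡ χ z
  χ-square-factor {t} z t≉0 =
    χ-ext (mk⇔ cancel-zero multiply-zero) (mk⇔ divide-square multiply-square)
    where
    open ≈-Reasoning
    t′ : ℕ
    t′ = proj₁ (inverse t≉0)
    tt′≈1 : t * t′ ≈ 1
    tt′≈1 = proj₂ (inverse t≉0)
    regroup : ∀ t s → (t * s) * (t * s) ≡ t * t * (s * s)
    regroup = solve-∀
    cancel-zero : t * t * z ≈ 0 → z ≈ 0
    cancel-zero t²z≈0 with ≈0-* t²z≈0
    ... | inj₁ t²≈0 = ⊥-elim ([ t≉0 , t≉0 ]′ (≈0-* t²≈0))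
    ... | inj₂ z≈0  = z≈0
    multiply-zero : z ≈ 0 → t * t * z ≈ 0
    multiply-zero z≈0 = ≈-trans (≈-* (≈-refl {t * t}) z≈0) (≡⇒≈ (ℕP.*-zeroʳ (t * t)))
    multiply-square : IsSquare z → IsSquare (t * t * z)
    multiply-square (s , s²≈z) = t * s , (begin
        (t * s) * (t * s)  ≡⟨ regroup t s ⟩
        t * t * (s * s)    ≈⟨ ≈-* (≈-refl {t * t}) s²≈z ⟩
        t * t * z          ∎)
    divide-square : IsSquare (t * t * z) → IsSquare z
    divide-square (s , s²≈t²z) = t′ * s , (begin
        (t′ * s) * (t′ * s)            ≡⟨ regroup t′ s ⟩
        t′ * t′ * (s * s)              ≈⟨ ≈-* (≈-refl {t′ * t′}) s²≈t²z ⟩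
        t′ * t′ * (t * t * z)          ≡⟨ collect t t′ z ⟩
        (t * t′) * (t * t′) * z        ≈⟨ ≈-* (≈-* tt′≈1 tt′≈1) (≈-refl {z}) ⟩
        1 * 1 * z                      ≡⟨ ℕP.+-identityʳ z ⟩
        z                              ∎)
      where
      collect : ∀ t t′ z → t′ * t′ * (t * t * z) ≡ (t * t′) * (t * t′) * z
      collect = solve-∀

  #roots : ℕ → ℤ
  #roots y = Σ p (λ x → δ ((x * x) % p) y 1ℤ)

  -- Every x in [0, p) is a square root of exactly one residue.
  Σ-#roots : Σ p #roots ≡ + p
  Σ-#roots = begin
      Σ p (λ y → Σ p (λ x → δ ((x * x) % p) y 1ℤ))
    ≡⟨ Σ-swap p p (λ y x → δ ((x * x) % p) y 1ℤ) ⟩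
      Σ p (λ x → Σ p (λ y → δ ((x * x) % p) y 1ℤ))
    ≡⟨ Σ-cong p (λ x _ → Σ-δ′ p ((x * x) % p) (λ _ → 1ℤ) (m%n<n (x * x) p)) ⟩
      Σ p (λ _ → 1ℤ)
    ≡⟨ Σ-one p ⟩
      + p
    ∎
    where open ≡-Reasoning

  #roots-0 : #roots 0 ≡ 1ℤ
  #roots-0 = trans (Σ-cong p (λ x x<p → δ-cong 1ℤ (root⇔ x<p))) (Σ-δ p 0 (λ _ → 1ℤ) 0<p)
    where
    root⇔ : ∀ {x} → x < p → ((x * x) % p ≡ 0 ⇔ x ≡ 0)
    root⇔ x<p = mk⇔ (square≈0 x<p ∘ ⟨_⟩) (λ x≡0 → cong (λ y → (y * y) % p) x≡0)

  -- Since p is odd, s and p - s are distinct square roots of s² when s ≢ 0.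
  #roots-square : ∀ {s} → s < p → s ≢ 0 → #roots ((s * s) % p) ≡ + 2
  #roots-square {s} s<p s≢0 = begin
      #roots ((s * s) % p)
    ≡⟨ Σ-cong p (λ x x<p → δ-split 1ℤ s≢p∸s (roots⇔ x<p)) ⟩
      Σ p (λ x → δ x s 1ℤ +ℤ δ x (p ∸ s) 1ℤ)
    ≡⟨ Σ-+ p (λ x → δ x s 1ℤ) (λ x → δ x (p ∸ s) 1ℤ) ⟩
      Σ p (λ x → δ x s 1ℤ) +ℤ Σ p (λ x → δ x (p ∸ s) 1ℤ)
    ≡⟨ cong₂ _+ℤ_ (Σ-δ p s (λ _ → 1ℤ) s<p) (Σ-δ p (p ∸ s) (λ _ → 1ℤ) p∸s<p) ⟩
      + 2
    ∎
    where
    open ≡-Reasoning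
    p∸s<p : p ∸ s < p
    p∸s<p = ℕP.∸-monoʳ-< (ℕP.n≢0⇒n>0 s≢0) (ℕP.<⇒≤ s<p)
    roots⇔ : ∀ {x} → x < p → ((x * x) % p ≡ (s * s) % p ⇔ (x ≡ s ⊎ x ≡ p ∸ s))
    roots⇔ x<p = mk⇔ (Equivalence.to (square-roots x<p s<p) ∘ ⟨_⟩)
                     (residue ∘ Equivalence.from (square-roots x<p s<p))
    s≢p∸s : s ≢ p ∸ s
    s≢p∸s s≡p∸s with prime⇒irreducible p-prime (divides {2} s p≡s*2)
      where
      twice : ∀ s → s + s ≡ s * 2
      twice = solve-∀
      p≡s*2 : p ≡ s * 2
      p≡s*2 = trans (sym (trans (cong (λ y → s + y) s≡p∸s) (ℕP.m+[n∸m]≡n (ℕP.<⇒≤ s<p)))) (twice s)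
    ... | inj₁ ()
    ... | inj₂ 2≡p = p≢2 (sym 2≡p)

  #roots-nonsquare : ∀ {y} → ¬ IsSquare y → #roots y ≡ 0ℤ
  #roots-nonsquare {y} y∉□ =
    Σ-zero p {λ x → δ ((x * x) % p) y 1ℤ} (λ x _ → δ-no 1ℤ (λ x²%p≡y → y∉□ (x , root {x} x²%p≡y)))
    where
    root : ∀ {x} → (x * x) % p ≡ y → x * x ≈ y
    root {x} x²%p≡y = ⟨ trans (sym (m%n%n≡m%n (x * x) p)) (cong (_% p) x²%p≡y) ⟩

  χ≡#roots-1 : ∀ {y} → y < p → χ y ≡ #roots y +ℤ -1ℤ
  χ≡#roots-1 {y} y<p with χ y | character y
  ... | _ | divisible y≈0 =
    sym (trans (cong (λ z → #roots z +ℤ -1ℤ) (≈⇒≡ y<p 0<p y≈0)) (cong (_+ℤ -1ℤ) #roots-0))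
  ... | _ | square y≉0 (s , s²≈y) =
    sym (cong (_+ℤ -1ℤ) (trans (cong #roots (sym r²%p≡y)) (#roots-square r<p r≢0)))
    where
    r : ℕ
    r = s % p
    r<p : r < p
    r<p = m%n<n s p
    r²≈y : r * r ≈ y
    r²≈y = ≈-trans (≈-* (%≈ s) (%≈ s)) s²≈y
    r²%p≡y : (r * r) % p ≡ y
    r²%p≡y = trans (residue r²≈y) (m<n⇒m%n≡m y<p)
    r≢0 : r ≢ 0
    r≢0 r≡0 = y≉0 (≈-trans (≈-sym r²≈y) (≡⇒≈ (cong (λ x → x * x) r≡0)))
  ... | _ | nonsquare _ y∉□ = sym (cong (_+ℤ -1ℤ) (#roots-nonsquare y∉□))

  -- Half of the nonzero residues are squares: Σ_y (y / p) = 0.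
  Σχ≡0 : Σ p χ ≡ 0ℤ
  Σχ≡0 = begin
      Σ p χ                            ≡⟨ Σ-cong p (λ y → χ≡#roots-1) ⟩
      Σ p (λ y → #roots y +ℤ -1ℤ)       ≡⟨ Σ-+ p #roots (λ _ → -1ℤ) ⟩
      Σ p #roots +ℤ Σ p (λ _ → - 1ℤ)    ≡⟨ cong₂ _+ℤ_ Σ-#roots Σ-minus-one ⟩
      + p +ℤ - + p                     ≡⟨ ℤP.+-inverseʳ (+ p) ⟩
      0ℤ                               ∎
    where
    open ≡-Reasoning
    Σ-minus-one : Σ p (λ _ → - 1ℤ) ≡ - + p
    Σ-minus-one = trans (Σ-neg p (λ _ → 1ℤ)) (cong -_ (Σ-one p))

  Σ-bijection : ∀ (σ τ : ℕ → ℕ) (f : ℕ → ℤ) →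
                (∀ x → x < p → τ (σ x % p) ≈ x) → (∀ y → y < p → σ (τ y % p) ≈ y) →
                Σ p (λ x → f (σ x % p)) ≡ Σ p f
  Σ-bijection σ τ f τσ≈id στ≈id =
    Σ-reindex p (λ x → σ x % p) (λ y → τ y % p) f (λ x _ → m%n<n (σ x) p) (λ y _ → m%n<n (τ y) p)
      (λ x x<p → ≈⇒≡ (m%n<n (τ (σ x % p)) p) x<p (≈-trans (%≈ _) (τσ≈id x x<p)))
      (λ y y<p → ≈⇒≡ (m%n<n (σ (τ y % p)) p) y<p (≈-trans (%≈ _) (στ≈id y y<p)))

  Σ-affine : ∀ {A} c (f : ℕ → ℤ) → ¬ A ≈ 0 → Σ p (λ u → f ((A * u + c) % p)) ≡ Σ p f
  Σ-affine {A} c f A≉0 = Σ-bijection (λ u → A * u + c) τ f τσ≈id στ≈id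
    where
    open ≈-Reasoning
    A′ : ℕ
    A′ = proj₁ (inverse A≉0)
    AA′≈1 : A * A′ ≈ 1
    AA′≈1 = proj₂ (inverse A≉0)
    -- d ≡ -c modulo p
    d : ℕ
    d = p ∸ c % p
    c+d≈0 : c + d ≈ 0
    c+d≈0 = begin
      c + d        ≈⟨ ≈-+ (≈-sym (%≈ c)) (≈-refl {d}) ⟩
      c % p + d    ≡⟨ ℕP.m+[n∸m]≡n (m%n≤n c p) ⟩
      p            ≈⟨ p≈0 ⟩
      0            ∎
    τ : ℕ → ℕ
    τ y = A′ * (y + d)
    τσ≈id : ∀ x → x < p → τ ((A * x + c) % p) ≈ x
    τσ≈id x _ = begin
      A′ * ((A * x + c) % p + d)   ≈⟨ ≈-* (≈-refl {A′}) (≈-+ (%≈ (A * x + c)) (≈-refl {d})) ⟩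
      A′ * ((A * x + c) + d)       ≡⟨ cong (A′ *_) (ℕP.+-assoc (A * x) c d) ⟩
      A′ * (A * x + (c + d))       ≈⟨ ≈-* (≈-refl {A′}) (≈-+ (≈-refl {A * x}) c+d≈0) ⟩
      A′ * (A * x + 0)             ≡⟨ cancel A A′ x ⟩
      (A * A′) * x                 ≈⟨ ≈-* AA′≈1 (≈-refl {x}) ⟩
      1 * x                        ≡⟨ ℕP.*-identityˡ x ⟩
      x                            ∎
      where
      cancel : ∀ A A′ x → A′ * (A * x + 0) ≡ (A * A′) * x
      cancel = solve-∀
    στ≈id : ∀ y → y < p → A * (τ y % p) + c ≈ y
    στ≈id y _ = begin
      A * (τ y % p) + c              ≈⟨ ≈-+ (≈-* (≈-refl {A}) (%≈ (τ y))) (≈-refl {c}) ⟩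
      A * (A′ * (y + d)) + c         ≡⟨ regroup A A′ y d c ⟩
      (A * A′) * (y + d) + c         ≈⟨ ≈-+ (≈-* AA′≈1 (≈-refl {y + d})) (≈-refl {c}) ⟩
      1 * (y + d) + c                ≡⟨ collect y d c ⟩
      y + (c + d)                    ≈⟨ ≈-+ (≈-refl {y}) c+d≈0 ⟩
      y + 0                          ≡⟨ ℕP.+-identityʳ y ⟩
      y                              ∎
      where
      regroup : ∀ A A′ y d c → A * (A′ * (y + d)) + c ≡ (A * A′) * (y + d) + c
      regroup = solve-∀
      collect : ∀ y d c → 1 * (y + d) + c ≡ y + (c + d)
      collect = solve-∀

  Σ-scale : ∀ {a} (f : ℕ → ℤ) → ¬ a ≈ 0 → Σ p (λ w → f ((a * w) % p)) ≡ Σ p f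
  Σ-scale {a} f a≉0 =
    trans (Σ-cong p (λ w _ → cong (λ m → f (m % p)) (sym (ℕP.+-identityʳ (a * w)))))
          (Σ-affine 0 f a≉0)

  Σχ-affine : ∀ {A} c → ¬ A ≈ 0 → Σ p (λ u → χ (A * u + c)) ≡ 0ℤ
  Σχ-affine {A} c A≉0 = begin
      Σ p (λ u → χ (A * u + c))          ≡⟨ Σ-cong p (λ u _ → χ-cong (≈-sym (%≈ (A * u + c)))) ⟩
      Σ p (λ u → χ ((A * u + c) % p))    ≡⟨ Σ-affine c χ A≉0 ⟩
      Σ p χ                              ≡⟨ Σχ≡0 ⟩
      0ℤ                                 ∎
    where open ≡-Reasoning

  module Vanishing {e h : ℕ} (e≡h+h : e ≡ h + h) {A : ℕ} (A≉0 : ¬ A ≈ 0) (B : ℕ) where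

    row : ℕ → ℤ
    row u = Σ p (λ v → χ (A * u ^ suc e + B * v ^ e))

    -- For a unit u, substitute v = u w and remove the square factor u^e = (u^h)².
    row-unit : ∀ {u} → ¬ u ≈ 0 → row u ≡ Σ p (λ w → χ (A * u + B * w ^ e))
    row-unit {u} u≉0 =
      trans (sym (Σ-scale (λ v → χ (A * u ^ suc e + B * v ^ e)) u≉0)) (Σ-cong p (λ w _ → term w))
      where
      t : ℕ
      t = u ^ h
      uᵉ≡t² : u ^ e ≡ t * t
      uᵉ≡t² = trans (cong (u ^_) e≡h+h) (ℕP.^-distribˡ-+-* u h h)
      factor : ∀ w → A * u ^ suc e + B * (u * w) ^ e ≡ t * t * (A * u + B * w ^ e)
      factor w = begin
          A * (u * u ^ e) + B * (u * w) ^ e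
        ≡⟨ cong (λ z → A * (u * u ^ e) + B * z) (^-distribʳ-* u w e) ⟩
          A * (u * u ^ e) + B * (u ^ e * w ^ e)
        ≡⟨ cong (λ z → A * (u * z) + B * (z * w ^ e)) uᵉ≡t² ⟩
          A * (u * (t * t)) + B * (t * t * w ^ e)
        ≡⟨ collect A B u t (w ^ e) ⟩
          t * t * (A * u + B * w ^ e)
        ∎
        where
        open ≡-Reasoning
        collect : ∀ A B u t W → A * (u * (t * t)) + B * (t * t * W) ≡ t * t * (A * u + B * W)
        collect = solve-∀
      term : ∀ w → χ (A * u ^ suc e + B * ((u * w) % p) ^ e) ≡ χ (A * u + B * w ^ e)
      term w = begin
          χ (A * u ^ suc e + B * ((u * w) % p) ^ e)
        ≡⟨ χ-cong (≈-+ (≈-refl {A * u ^ suc e}) B*[uw%p]ᵉ≈B*[uw]ᵉ) ⟩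
          χ (A * u ^ suc e + B * (u * w) ^ e)
        ≡⟨ cong χ (factor w) ⟩
          χ (t * t * (A * u + B * w ^ e))
        ≡⟨ χ-square-factor _ (≉0-^ h u≉0) ⟩
          χ (A * u + B * w ^ e)
        ∎
        where
        open ≡-Reasoning
        B*[uw%p]ᵉ≈B*[uw]ᵉ : B * ((u * w) % p) ^ e ≈ B * (u * w) ^ e
        B*[uw%p]ᵉ≈B*[uw]ᵉ = ≈-* (≈-refl {B}) (≈-^ e (%≈ (u * w)))

    -- The row u = 0 cancels against the sum of all other rows.
    Σ-rows : Σ p row ≡ 0ℤ
    Σ-rows = begin
        row 0 +ℤ Σ k (row ∘ suc)
      ≡⟨ cong (row 0 +ℤ_) (Σ-cong k (λ u u<k → row-unit (suc≉0 u<k))) ⟩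
        row 0 +ℤ Σ k (λ u → Σ p (λ w → χ (A * suc u + B * w ^ e)))
      ≡⟨ cong (row 0 +ℤ_) (Σ-swap k p (λ u w → χ (A * suc u + B * w ^ e))) ⟩
        row 0 +ℤ Σ p (λ w → Σ k (λ u → χ (A * suc u + B * w ^ e)))
      ≡⟨ cong (row 0 +ℤ_) (Σ-cong p (λ w _ → other-columns (B * w ^ e))) ⟩
        row 0 +ℤ Σ p (λ w → - χ (A * 0 + B * w ^ e))
      ≡⟨ cong (row 0 +ℤ_) (Σ-neg p (λ w → χ (A * 0 + B * w ^ e))) ⟩
        row 0 +ℤ - row 0
      ≡⟨ ℤP.+-inverseʳ (row 0) ⟩
        0ℤ
      ∎
      where
      open ≡-Reasoning
      suc≉0 : ∀ {u} → u < k → ¬ suc u ≈ 0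
      suc≉0 u<k su≈0 with ≈⇒≡ (s≤s u<k) 0<p su≈0
      ... | ()
      -- Σ_{u=1}^{p-1} (A u + c / p) = -(c / p), as the full affine sum vanishes.
      other-columns : ∀ c → Σ k (λ u → χ (A * suc u + c)) ≡ - χ (A * 0 + c)
      other-columns c = inverseʳ-unique (χ (A * 0 + c)) _ (Σχ-affine c A≉0)

    -- The same double sum over [1, p] × [1, p], by periodicity.
    vanishing : Σ p (λ u → Σ p (λ v → χ (A * suc u ^ suc e + B * suc v ^ e))) ≡ 0ℤ
    vanishing = begin
        Σ p (λ u → Σ p (λ v → χ (A * suc u ^ suc e + B * suc v ^ e)))
      ≡⟨ Σ-cong p (λ u _ → Σ-shift p (λ v → χ (A * suc u ^ suc e + B * v ^ e)) (periodic-in-v u)) ⟩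
        Σ p (row ∘ suc)
      ≡⟨ Σ-shift p row (Σ-cong p (λ v _ → periodic-in-u v)) ⟩
        Σ p row
      ≡⟨ Σ-rows ⟩
        0ℤ
      ∎
      where
      open ≡-Reasoning
      periodic-in-v : ∀ u → χ (A * suc u ^ suc e + B * p ^ e) ≡ χ (A * suc u ^ suc e + B * 0 ^ e)
      periodic-in-v u = χ-cong (≈-+ (≈-refl {A * suc u ^ suc e}) (≈-* (≈-refl {B}) (≈-^ e p≈0)))
      periodic-in-u : ∀ v → χ (A * p ^ suc e + B * v ^ e) ≡ χ (A * 0 ^ suc e + B * v ^ e)
      periodic-in-u v = χ-cong (≈-+ (≈-* (≈-refl {A}) (≈-^ (suc e) p≈0)) (≈-refl {B * v ^ e}))

sumℤ-oneTo : ∀ m (f : ℕ → ℕ) (g : ℕ → ℤ) →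
             sumℤ (map g (map suc (applyUpTo f m))) ≡ Σ m (g ∘ suc ∘ f)
sumℤ-oneTo zero    f g = refl
sumℤ-oneTo (suc m) f g = cong (g (suc (f 0)) +ℤ_) (sumℤ-oneTo m (f ∘ suc) g)

S≡Σ : ∀ n ℓ → S n ℓ ≡ Σ ℓ (λ u → Σ ℓ (λ v → legendre (Δ n (suc u) (suc v)) ℓ))
S≡Σ n ℓ = trans (sumℤ-oneTo ℓ id _) (Σ-cong ℓ (λ u _ → sumℤ-oneTo ℓ id _))

∣legendre∣≤1 : ∀ a ℓ → ∣ legendre a ℓ ∣ ≤ 1
∣legendre∣≤1 a zero    = z≤n
∣legendre∣≤1 a (suc k) with a % suc k ℕ.≟ 0
... | yes _ = z≤n
... | no  _ with any (λ x → ⌊ (x * x) % suc k ℕ.≟ a % suc k ⌋) (upTo (suc k))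
...   | true  = s≤s z≤n
...   | false = s≤s z≤n

S-trivial-bound : ∀ n ℓ → ∣ S n ℓ ∣ ≤ ℓ * ℓ
S-trivial-bound n ℓ = subst₂ (λ s b → ∣ s ∣ ≤ b) (sym (S≡Σ n ℓ)) (cong (ℓ *_) (ℕP.*-identityʳ ℓ))
  (Σ-bound ℓ (ℓ * 1) _ (λ u → Σ-bound ℓ 1 _ (λ v → ∣legendre∣≤1 _ ℓ)))

S-vanishes : ∀ n ℓ → Prime ℓ → ℓ ≢ 2 → 2 ≤ n → n < ℓ → n % 2 ≡ 1 → S n ℓ ≡ 0ℤ
S-vanishes (suc e) (suc k) ℓ-prime ℓ≢2 (s≤s 1≤e) n<ℓ n-odd =
  trans (S≡Σ (suc e) (suc k)) (Vanishing.vanishing {e} {h} e≡h+h (≉0-^ e e≉0) (suc e ^ suc e))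
  where
  open OddPrime k ℓ-prime ℓ≢2
  -- e = n - 1 = 2h, and A = e^e is a unit because 0 < e < ℓ.
  h : ℕ
  h = suc e / 2
  e≡h+h : e ≡ h + h
  e≡h+h = ℕP.suc-injective (begin
      suc e              ≡⟨ m≡m%n+[m/n]*n (suc e) 2 ⟩
      suc e % 2 + h * 2  ≡⟨ cong (_+ h * 2) n-odd ⟩
      suc (h * 2)        ≡⟨ cong suc (double h) ⟩
      suc (h + h)        ∎)
    where
    open ≡-Reasoning
    double : ∀ h → h * 2 ≡ h + h
    double = solve-∀
  e≉0 : ¬ e ≈ 0
  e≉0 e≈0 = ℕP.<⇒≢ 1≤e (sym (≈⇒≡ (ℕP.<-trans (ℕP.n<1+n e) n<ℓ) 0<p e≈0))

lemma1 : (n : ℕ) → 5 ≤ n → n % 4 ≡ 1 →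
    ∃[ c ] ((ℓ : ℕ) → Prime ℓ → ℓ ≢ 2 → ∣ S n ℓ ∣ ≤ c * ℓ)
lemma1 n 5≤n n%4≡1 = n , bound
  where
  n-odd : n % 2 ≡ 1
  n-odd = trans (sym (m∣n⇒o%n%m≡o%m 2 4 n (divides 2 refl))) (cong (_% 2) n%4≡1)
  2≤n : 2 ≤ n
  2≤n = ℕP.≤-trans (s≤s (s≤s z≤n)) 5≤n
  -- Small primes: the trivial bound ℓ² ≤ n ℓ.  Large primes: the sum is 0.
  bound : (ℓ : ℕ) → Prime ℓ → ℓ ≢ 2 → ∣ S n ℓ ∣ ≤ n * ℓ
  bound ℓ ℓ-prime ℓ≢2 with ℓ ℕ.≤? n
  ... | yes ℓ≤n = ℕP.≤-trans (S-trivial-bound n ℓ) (ℕP.*-monoˡ-≤ ℓ ℓ≤n)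
  ... | no  ℓ≰n rewrite S-vanishes n ℓ ℓ-prime ℓ≢2 2≤n (ℕP.≰⇒> ℓ≰n) n-odd = z≤n
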